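{- Let $\mathcal{P}=(V;\leq_{\mathcal{P}})$ be a finite poset with $|V|=n$, let $\leq_{\mathcal{Q}}$ be a partial order on $V$ extending $\leq_{\mathcal{P}}$ (i.e. $\leq_{\mathcal{P}}\subseteq\leq_{\mathcal{Q}}$), and let $\omega:V\to\mathbb{R}$ be a weight function that is increasing on $\mathcal{Q}$: $u\leq_{\mathcal{Q}}v\Rightarrow\omega(u)\leq\omega(v)$. Extend $\omega$ additively to subsets, $\omega(S)=\sum_{v\in S}\omega(v)$. Let $\tau:V\to\{1,\dots,n\}$ be a bijection with $u\leq_{\mathcal{Q}}v\Rightarrow\tau(u)\leq\tau(v)$, and let $a\in V$. Define $\varphi_{a,\tau}:\mathcal{I}(\mathcal{P})\to\mathcal{I}(\mathcal{P})$ as follows: for $I\in\mathcal{I}(\mathcal{P})$, let $A_I=\{v\in I: a\leq_{\mathcal{Q}}v\}$ and $B_I=\{u\in V\setminus I: u<_{\mathcal{Q}}a\}$; if both are nonempty, let $v_{\max}$ be the element of $A_I$ with largest $\tau$-value and $v_{\min}$ the element of $B_I$ with smallest $\tau$-value and set $\varphi_{a,\tau}(I)=(I\setminus\{v_{\max}\})\cup\{v_{\min}\}$; otherwise set $\varphi_{a,\tau}(I)=I$. Then $\varphi_{a,\tau}$ is a Steiner operation for the minimum weight ideal problem on $(\mathcal{P};\omega)$, i.e. $\varphi_{a,\tau}$ maps $\mathcal{I}(\mathcal{P})$ into $\mathcal{I}(\mathcal{P})$ and for all $I,J\in\mathcal{I}(\mathcal{P})$: (1) $|\varphi_{a,\tau}(I)|=|I|$;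 (2) $\omega(\varphi_{a,\tau}(I))\leq\omega(I)$; (3) $I\subseteq J\Rightarrow\varphi_{a,\tau}(I)\subseteq\varphi_{a,\tau}(J)$; (4) with $\tau(S)=\sum_{x\in S}\tau(x)$, $\tau(\varphi_{a,\tau}(I))\leq\tau(I)$, with equality if and only if $\varphi_{a,\tau}(I)=I$.
   Context: For a finite poset $\mathcal{P}=(V;\leq)$, a set $I\subseteq V$ is an (order) ideal if $y\in I$ and $x\leq y$ imply $x\in I$; $\mathcal{I}(\mathcal{P})$ denotes the set of all ideals of $\mathcal{P}$. $u<_{\mathcal{Q}}a$ means $u\leq_{\mathcal{Q}}a$ and $u\neq a$. The minimum weight ideal (MWI) problem on $(\mathcal{P};\omega)$ is to minimize $\omega(I)$ over $I\in\mathcal{I}(\mathcal{P})$ with $|I|=k$; a Steiner operation for it is one whose boundary functional is the weight $\omega$. -}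

module Defs where

open import Level using (Level; _⊔_) renaming (suc to lsuc)
open import Data.Nat using (ℕ; zero; suc; _+_; _<ᵇ_)
open import Data.Bool using (Bool; true; false; if_then_else_; _∧_; not)
open import Data.Maybe using (Maybe; just; nothing)
open import Data.Fin using (Fin; toℕ; _≟_)
import Data.Fin as Fin
open import Data.Fin.Subset using (Subset; _∈_; _∪_; _-_; ⁅_⁆)
open import Data.Vec using (Vec; []; _∷_; lookup)
open import Data.List using (List; foldr; allFin)
open import Relation.Binary using (Rel; Decidable; IsPreorder)
open import Relation.Nullary.Decidable using (⌊_⌋)
open import Algebra.Bundles using (CommutativeMonoid)

-- An ordered commutative monoid: the weights live here (ℝ with + and ≤ is an instance).
record OrderedCommutativeMonoid (c ℓ₁ ℓ₂ : Level) : Set (lsuc (c ⊔ ℓ₁ ⊔ ℓ₂)) where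
  field
    commutativeMonoid : CommutativeMonoid c ℓ₁
  open CommutativeMonoid commutativeMonoid public
  infix 4 _≤_
  field
    _≤_ : Rel Carrier ℓ₂
    ≤-isPreorder : IsPreorder _≈_ _≤_
    ∙-mono-≤ : ∀ {x y u v} → x ≤ y → u ≤ v → (x ∙ u) ≤ (y ∙ v)

module _ {c ℓ₁ ℓ₂} (M : OrderedCommutativeMonoid c ℓ₁ ℓ₂) where
  open OrderedCommutativeMonoid M
  weight : ∀ {n} → (Fin n → Carrier) → Subset n → Carrier
  weight ω [] = ε
  weight ω (b ∷ S) = (if b then ω Fin.zero else ε) ∙ weight (λ x → ω (Fin.suc x)) S

sumℕ : ∀ {n} → (Fin n → ℕ) → Subset n → ℕ
sumℕ f [] = 0
sumℕ f (b ∷ S) = (if b then f Fin.zero else 0) + sumℕ (λ x → f (Fin.suc x)) S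

-- τ as a map into {1,…,n}: the element v gets value toℕ (τ v) + 1
τval : ∀ {n} → (Fin n → Fin n) → Fin n → ℕ
τval τ v = suc (toℕ (τ v))

IsIdeal : ∀ {n ℓ} → Rel (Fin n) ℓ → Subset n → Set ℓ
IsIdeal _≤P_ I = ∀ {x y} → y ∈ I → x ≤P y → x ∈ I

pickMax pickMin : ∀ {n} → (Fin n → Fin n) → (Fin n → Bool) → Maybe (Fin n)
pickMax {n} τ p = foldr step nothing (allFin n)
  where
  step : Fin n → Maybe (Fin n) → Maybe (Fin n)
  step x nothing = if p x then just x else nothing
  step x (just y) = if p x ∧ (toℕ (τ y) <ᵇ toℕ (τ x)) then just x else just y
pickMin {n} τ p = foldr step nothing (allFin n)
  where
  step : Fin n → Maybe (Fin n) → Maybe (Fin n)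
  step x nothing = if p x then just x else nothing
  step x (just y) = if p x ∧ (toℕ (τ x) <ᵇ toℕ (τ y)) then just x else just y

module _ {n ℓ} {_≤Q_ : Rel (Fin n) ℓ} (_≤Q?_ : Decidable _≤Q_)
         (τ : Fin n → Fin n) (a : Fin n) where
  inA : Subset n → Fin n → Bool
  inA I v = lookup I v ∧ ⌊ a ≤Q? v ⌋
  inB : Subset n → Fin n → Bool
  inB I u = not (lookup I u) ∧ (⌊ u ≤Q? a ⌋ ∧ not ⌊ u ≟ a ⌋)

  φ : Subset n → Subset n
  φ I with pickMax τ (inA I) | pickMin τ (inB I)
  ... | just vmax | just vmin = (I - vmax) ∪ ⁅ vmin ⁆
  ... | _ | _ = I

module Submission where

-- When A_I and B_I are both nonempty, φ swaps v ∈ A_I for u ∈ B_I, and u <_Q a ≤_Q v.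
-- As ω and τ are Q-monotone, the swap keeps |I|, does not increase ω(I), and strictly
-- decreases τ(I) because τ is injective. For an ideal I, a pair x ≤_P y ∈ φ(I) with
-- x ∉ φ(I) would need x = v (then y ∈ A_I, so τ(v) ≤ τ(y) ≤ τ(v) by maximality and y = v)
-- or x ∈ B_I below u (then τ(u) ≤ τ(x) ≤ τ(u) by minimality and x = u).
-- If I ⊆ J then A_I ⊆ A_J and B_J ⊆ B_I, and the same extremality argument
-- shows φ(I) ⊆ φ(J).

open import Defs
open import Level using (0ℓ)
import Algebra.Properties.CommutativeSemigroup as CommutativeSemigroupProperties
open import Data.Bool using (Bool; true; false; if_then_else_; _∧_; T)
open import Data.Bool.Properties using (T-≡)
open import Data.Fin using (Fin; zero; suc; toℕ; _≟_)
open import Data.Fin.Properties using (toℕ-injective)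
open import Data.Fin.Subset using (Subset; inside; outside; _∈_; _∉_; _⊆_; _∪_; _─_; _-_; ⁅_⁆; ∣_∣)
open import Data.Fin.Subset.Properties
  using (x∈⁅x⁆; x∈⁅y⁆⇒x≡y; x∈p∪q⁺; x∈p∪q⁻; ∪-identityʳ; p─⊥≡p; p─q⊆p; x∈p∧x≢y⇒x∈p-y; _∈?_)
open import Data.List using (List; []; _∷_; foldr; allFin)
import Data.List.Membership.Propositional as List
open import Data.List.Membership.Propositional.Properties using (∈-allFin)
open import Data.List.Relation.Unary.Any using (here; there)
open import Data.Maybe using (Maybe; just; nothing)
open import Data.Nat using (ℕ; suc; s≤s; _+_; _≤_; _≥_; _<_; _<ᵇ_)
open import Data.Nat.Properties
  using (≤-refl; ≤-trans; <⇒≤; ≮⇒≥; ≤-antisym; ≤-pred; ≤∧≢⇒<; <⇒≢; <ᵇ⇒<; <⇒<ᵇ;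
         ≤-isPreorder; +-mono-≤; +-monoˡ-<; +-0-commutativeMonoid; module ≤-Reasoning)
open import Data.Product using (_×_; _,_; proj₁; proj₂; uncurry)
open import Data.Sum using (_⊎_; inj₁; inj₂)
open import Data.Vec using ([]; _∷_; lookup; here; there)
open import Data.Vec.Properties using ([]=⇒lookup; lookup⇒[]=)
open import Function using (_∘_; flip; _on_; _⇔_; mk⇔; Equivalence)
open import Function.Definitions using (Injective; Bijective)
open import Relation.Binary using (Rel; Reflexive; Transitive; IsPreorder; IsPartialOrder; IsDecPartialOrder)
open import Relation.Binary.PropositionalEquality using (_≡_; _≢_; refl)
import Relation.Binary.PropositionalEquality as ≡
open import Relation.Nullary using (¬_; yes; no; contradiction)
open import Relation.Nullary.Decidable using (decidable-stable)

private
  variable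
    m : ℕ

≡false⇒≢true : ∀ {b} → b ≡ false → b ≢ true
≡false⇒≢true refl ()

<ᵇ≡true⇒< : ∀ {i j} → (i <ᵇ j) ≡ true → i < j
<ᵇ≡true⇒< {i} {j} i<ᵇj = <ᵇ⇒< i j (Equivalence.from T-≡ i<ᵇj)

<ᵇ≡false⇒≥ : ∀ {i j} → (i <ᵇ j) ≡ false → i ≥ j
<ᵇ≡false⇒≥ i≮ᵇj = ≮⇒≥ λ i<j → ≡.subst T i≮ᵇj (<⇒<ᵇ i<j)

exchange : Subset m → Fin m → Fin m → Subset m
exchange I v u = (I - v) ∪ ⁅ u ⁆

x∈p─q⇒x∉q : ∀ {p q : Subset m} {x} → x ∈ p ─ q → x ∉ q
x∈p─q⇒x∉q {p = _ ∷ _} {outside ∷ _} here ()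
x∈p─q⇒x∉q {p = _ ∷ _} {_ ∷ _} (there x∈p─q) (there x∈q) = x∈p─q⇒x∉q x∈p─q x∈q

x∈p-y⇒x≢y : ∀ {p : Subset m} {x y} → x ∈ p - y → x ≢ y
x∈p-y⇒x≢y x∈p-y refl = x∈p─q⇒x∉q x∈p-y (x∈⁅x⁆ _)

module _ {I : Subset m} {v u : Fin m} where

  exchange-∈⁺ : ∀ {x} → (x ≢ u → x ∈ I × x ≢ v) → x ∈ exchange I v u
  exchange-∈⁺ {x} h with x ≟ u
  ... | yes refl = x∈p∪q⁺ (inj₂ (x∈⁅x⁆ u))
  ... | no x≢u = x∈p∪q⁺ (inj₁ (uncurry x∈p∧x≢y⇒x∈p-y (h x≢u)))

  exchange-∈⁻ : ∀ {x} → x ∈ exchange I v u → x ≡ u ⊎ (x ∈ I × x ≢ v)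
  exchange-∈⁻ x∈ with x∈p∪q⁻ (I - v) ⁅ u ⁆ x∈
  ... | inj₁ x∈I-v = inj₂ (p─q⊆p I ⁅ v ⁆ x∈I-v , x∈p-y⇒x≢y x∈I-v)
  ... | inj₂ x∈⁅u⁆ = inj₁ (x∈⁅y⁆⇒x≡y u x∈⁅u⁆)

  exchange-⊆ : ∀ {S} → u ∈ S → (∀ {x} → x ∈ I → x ≢ v → x ∈ S) → exchange I v u ⊆ S
  exchange-⊆ u∈S I-v⊆S x∈ with exchange-∈⁻ x∈
  ... | inj₁ refl = u∈S
  ... | inj₂ (x∈I , x≢v) = I-v⊆S x∈I x≢v

module _ {c ℓ₁ ℓ₂} (M : OrderedCommutativeMonoid c ℓ₁ ℓ₂) where
  private
    module M = OrderedCommutativeMonoid M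
    module ≲ = IsPreorder M.≤-isPreorder
  open M using (Carrier; _≈_; _∙_; ∙-congˡ; ∙-mono-≤) renaming (_≤_ to _≲_)
  open CommutativeSemigroupProperties M.commutativeSemigroup using (x∙yz≈y∙xz)

  private
    weight-∷-shift : ∀ (ω : Fin (suc m) → Carrier) b {S S′ : Subset m} {y} →
                     weight M (ω ∘ suc) S′ ≈ y ∙ weight M (ω ∘ suc) S →
                     weight M ω (b ∷ S′) ≈ y ∙ weight M ω (b ∷ S)
    weight-∷-shift ω b S′≈y∙S = M.trans (∙-congˡ S′≈y∙S) (x∙yz≈y∙xz _ _ _)

  weight-∪⁅⁆ : ∀ (ω : Fin m → Carrier) {S : Subset m} {x} → x ∉ S →
               weight M ω (S ∪ ⁅ x ⁆) ≈ ω x ∙ weight M ω S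
  weight-∪⁅⁆ ω {inside ∷ S} {zero} x∉S = contradiction here x∉S
  weight-∪⁅⁆ ω {outside ∷ S} {zero} _ =
    ∙-congˡ (M.trans (M.reflexive (≡.cong (weight M (ω ∘ suc)) (∪-identityʳ S))) (M.sym (M.identityˡ _)))
  weight-∪⁅⁆ ω {inside ∷ S} {suc x} x∉S = weight-∷-shift ω inside {S} {S ∪ ⁅ x ⁆} (weight-∪⁅⁆ (ω ∘ suc) (x∉S ∘ there))
  weight-∪⁅⁆ ω {outside ∷ S} {suc x} x∉S = weight-∷-shift ω outside {S} {S ∪ ⁅ x ⁆} (weight-∪⁅⁆ (ω ∘ suc) (x∉S ∘ there))

  weight-remove : ∀ (ω : Fin m → Carrier) {S : Subset m} {x} → x ∈ S →
                  weight M ω S ≈ ω x ∙ weight M ω (S - x)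
  weight-remove ω {inside ∷ S} here =
    ∙-congˡ (M.trans (M.reflexive (≡.cong (weight M (ω ∘ suc)) (≡.sym (p─⊥≡p S)))) (M.sym (M.identityˡ _)))
  weight-remove ω {b ∷ S} {suc x} (there x∈S) = weight-∷-shift ω b {S - x} {S} (weight-remove (ω ∘ suc) x∈S)

  weight-exchange : ∀ (ω : Fin m → Carrier) {I : Subset m} {v u} → u ∉ I →
                    weight M ω (exchange I v u) ≈ ω u ∙ weight M ω (I - v)
  weight-exchange ω {I} {v} u∉I = weight-∪⁅⁆ ω (u∉I ∘ p─q⊆p I ⁅ v ⁆)

  weight-exchange-≤ : ∀ (ω : Fin m → Carrier) {I : Subset m} {v u} → v ∈ I → u ∉ I → ω u ≲ ω v →
                      weight M ω (exchange I v u) ≲ weight M ω I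
  weight-exchange-≤ ω v∈I u∉I ωu≤ωv =
    ≲.trans (≲.reflexive (weight-exchange ω u∉I))
      (≲.trans (∙-mono-≤ ωu≤ωv ≲.refl) (≲.reflexive (M.sym (weight-remove ω v∈I))))

+-ordered : OrderedCommutativeMonoid 0ℓ 0ℓ 0ℓ
+-ordered = record
  { commutativeMonoid = +-0-commutativeMonoid
  ; _≤_ = _≤_
  ; ≤-isPreorder = ≤-isPreorder
  ; ∙-mono-≤ = +-mono-≤
  }

sumℕ≡weight : ∀ (f : Fin m → ℕ) S → sumℕ f S ≡ weight +-ordered f S
sumℕ≡weight f [] = refl
sumℕ≡weight f (b ∷ S) = ≡.cong (_ +_) (sumℕ≡weight (f ∘ suc) S)

∣S∣≡sumℕ1 : ∀ (S : Subset m) → ∣ S ∣ ≡ sumℕ (λ _ → 1) S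
∣S∣≡sumℕ1 [] = refl
∣S∣≡sumℕ1 (inside ∷ S) = ≡.cong suc (∣S∣≡sumℕ1 S)
∣S∣≡sumℕ1 (outside ∷ S) = ∣S∣≡sumℕ1 S

sumℕ-exchange : ∀ (f : Fin m → ℕ) {I v u} → u ∉ I →
                sumℕ f (exchange I v u) ≡ f u + sumℕ f (I - v)
sumℕ-exchange f {I} {v} {u} u∉I = ≡.trans (sumℕ≡weight f (exchange I v u))
  (≡.trans (weight-exchange +-ordered f u∉I) (≡.cong (f u +_) (≡.sym (sumℕ≡weight f (I - v)))))

sumℕ-remove : ∀ (f : Fin m → ℕ) {I v} → v ∈ I → sumℕ f I ≡ f v + sumℕ f (I - v)
sumℕ-remove f {I} {v} v∈I = ≡.trans (sumℕ≡weight f I)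
  (≡.trans (weight-remove +-ordered f v∈I) (≡.cong (f v +_) (≡.sym (sumℕ≡weight f (I - v)))))

sumℕ-exchange-< : ∀ (f : Fin m → ℕ) {I v u} → v ∈ I → u ∉ I → f u < f v →
                  sumℕ f (exchange I v u) < sumℕ f I
sumℕ-exchange-< f {I} {v} {u} v∈I u∉I fu<fv = begin-strict
  sumℕ f (exchange I v u) ≡⟨ sumℕ-exchange f u∉I ⟩
  f u + sumℕ f (I - v)    <⟨ +-monoˡ-< (sumℕ f (I - v)) fu<fv ⟩
  f v + sumℕ f (I - v)    ≡⟨ sumℕ-remove f v∈I ⟨
  sumℕ f I                ∎
  where open ≤-Reasoning

∣exchange∣≡∣I∣ : ∀ {I : Subset m} {v u} → v ∈ I → u ∉ I → ∣ exchange I v u ∣ ≡ ∣ I ∣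
∣exchange∣≡∣I∣ {I = I} {v} {u} v∈I u∉I = begin
  ∣ exchange I v u ∣          ≡⟨ ∣S∣≡sumℕ1 (exchange I v u) ⟩
  sumℕ one (exchange I v u)  ≡⟨ sumℕ-exchange one u∉I ⟩
  1 + sumℕ one (I - v)       ≡⟨ sumℕ-remove one v∈I ⟨
  sumℕ one I                 ≡⟨ ∣S∣≡sumℕ1 I ⟨
  ∣ I ∣                       ∎
  where
  open ≡.≡-Reasoning
  one : Fin _ → ℕ
  one _ = 1

module _ {n ℓ} (p : Fin n → Bool) (_≼_ : Rel (Fin n) ℓ) where

  data Extremum (xs : List (Fin n)) : Maybe (Fin n) → Set ℓ where
    none : (∀ {x} → x List.∈ xs → p x ≡ false) → Extremum xs nothing
    best : ∀ {y} → p y ≡ true → (∀ {x} → x List.∈ xs → p x ≡ true → x ≼ y) → Extremum xs (just y)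

  -- pickMax and pickMin fold a where-bound step function, so the fold lemma
  -- abstracts over the step and takes its two defining equations instead.
  module _ (≼-refl : Reflexive _≼_) (≼-trans : Transitive _≼_)
           (beats : Fin n → Fin n → Bool)
           (beats⇒≽ : ∀ {x y} → beats x y ≡ true → y ≼ x)
           (¬beats⇒≼ : ∀ {x y} → beats x y ≡ false → x ≼ y)
           (step : Fin n → Maybe (Fin n) → Maybe (Fin n))
           (step-nothing : ∀ x → step x nothing ≡ (if p x then just x else nothing))
           (step-just : ∀ x y → step x (just y) ≡ (if p x ∧ beats x y then just x else just y))
           where

    foldr-extremum : ∀ xs → Extremum xs (foldr step nothing xs)
    foldr-extremum [] = none λ ()
    foldr-extremum (x ∷ xs) with foldr step nothing xs | foldr-extremum xs
    ... | nothing | none none-in-xs rewrite step-nothing x with p x in px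
    ...   | true  = best px λ { (here refl) _ → ≼-refl
                              ; (there z∈xs) pz → contradiction pz (≡false⇒≢true (none-in-xs z∈xs)) }
    ...   | false = none λ { (here refl) → px ; (there z∈xs) → none-in-xs z∈xs }
    foldr-extremum (x ∷ xs) | just y | best py y-best rewrite step-just x y with p x in px | beats x y in bxy
    ...   | true  | true  = best px λ { (here refl) _ → ≼-refl
                                      ; (there z∈xs) pz → ≼-trans (y-best z∈xs pz) (beats⇒≽ bxy) }
    ...   | true  | false = best py λ { (here refl) _ → ¬beats⇒≼ bxy ; (there z∈xs) → y-best z∈xs }
    ...   | false | _     = best py λ { (here refl) pz → contradiction pz (≡false⇒≢true px)
                                      ; (there z∈xs) → y-best z∈xs }

module _ {n} (τ : Fin n → Fin n) (p : Fin n → Bool) where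

  pickMax-extremum : Extremum p (_≤_ on (toℕ ∘ τ)) (allFin n) (pickMax τ p)
  pickMax-extremum = foldr-extremum p _ ≤-refl ≤-trans _ (<⇒≤ ∘ <ᵇ≡true⇒<) <ᵇ≡false⇒≥
    _ (λ _ → refl) (λ _ _ → refl) (allFin n)

  pickMin-extremum : Extremum p (_≥_ on (toℕ ∘ τ)) (allFin n) (pickMin τ p)
  pickMin-extremum = foldr-extremum p _ ≤-refl (flip ≤-trans) _ (<⇒≤ ∘ <ᵇ≡true⇒<) <ᵇ≡false⇒≥
    _ (λ _ → refl) (λ _ _ → refl) (allFin n)

module ExchangeOperation
  {n ℓ} {_≤Q_ : Rel (Fin n) ℓ} (Q-po : IsDecPartialOrder _≡_ _≤Q_)
  (τ : Fin n → Fin n) (τ-injective : Injective _≡_ _≡_ τ)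
  (τ-mono : ∀ {u v} → u ≤Q v → τval τ u ≤ τval τ v)
  (a : Fin n) where

  open IsDecPartialOrder Q-po using () renaming (_≤?_ to _≤Q?_; trans to ≤Q-trans; antisym to ≤Q-antisym)

  φa : Subset n → Subset n
  φa = φ _≤Q?_ τ a

  _<Q_ : Rel (Fin n) ℓ
  u <Q v = u ≤Q v × u ≢ v

  τ# : Fin n → ℕ
  τ# = toℕ ∘ τ

  τ#-mono : ∀ {u v} → u ≤Q v → τ# u ≤ τ# v
  τ#-mono = ≤-pred ∘ τ-mono

  τsum : Subset n → ℕ
  τsum = sumℕ (τval τ)

  τ#-injective : ∀ {u v} → τ# u ≤ τ# v → τ# v ≤ τ# u → u ≡ v
  τ#-injective τu≤τv τv≤τu = τ-injective (toℕ-injective (≤-antisym τu≤τv τv≤τu))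

  ∉⇒lookup : ∀ {S : Subset n} {x} → x ∉ S → lookup S x ≡ false
  ∉⇒lookup {S} {x} x∉S with lookup S x in eq
  ... | true = contradiction (lookup⇒[]= x S eq) x∉S
  ... | false = refl

  inA-sound : ∀ I {x} → inA _≤Q?_ τ a I x ≡ true → x ∈ I × a ≤Q x
  inA-sound I {x} h with lookup I x in x∈I | a ≤Q? x
  ... | true | yes a≤x = lookup⇒[]= x I x∈I , a≤x

  inA-complete : ∀ {I x} → x ∈ I → a ≤Q x → inA _≤Q?_ τ a I x ≡ true
  inA-complete {I} {x} x∈I a≤x rewrite []=⇒lookup x∈I with a ≤Q? x
  ... | yes _ = refl
  ... | no a≰x = contradiction a≤x a≰x

  inB-sound : ∀ I {x} → inB _≤Q?_ τ a I x ≡ true → x ∉ I × x <Q a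
  inB-sound I {x} h with lookup I x in x∉I | x ≤Q? a | x ≟ a
  ... | false | yes x≤a | no x≢a = ≡false⇒≢true x∉I ∘ []=⇒lookup , x≤a , x≢a

  inB-complete : ∀ {I x} → x ∉ I → x <Q a → inB _≤Q?_ τ a I x ≡ true
  inB-complete {I} {x} x∉I (x≤a , x≢a) rewrite ∉⇒lookup x∉I with x ≤Q? a | x ≟ a
  ... | yes _ | no _ = refl
  ... | no x≰a | _ = contradiction x≤a x≰a
  ... | _ | yes x≡a = contradiction x≡a x≢a

  record Exchange (I : Subset n) (v u : Fin n) : Set ℓ where
    field
      v∈I     : v ∈ I
      a≤v     : a ≤Q v
      v-last  : ∀ {x} → x ∈ I → a ≤Q x → τ# x ≤ τ# v
      u∉I     : u ∉ I
      u<a     : u <Q a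
      u-first : ∀ {x} → x ∉ I → x <Q a → τ# u ≤ τ# x

    u≤a : u ≤Q a
    u≤a = proj₁ u<a

    u≢a : u ≢ a
    u≢a = proj₂ u<a

    τ#u<τ#v : τ# u < τ# v
    τ#u<τ#v = ≤∧≢⇒< (τ#-mono (≤Q-trans u≤a a≤v)) λ τu≡τv →
      u∉I (≡.subst (_∈ I) (≡.sym (τ-injective (toℕ-injective τu≡τv))) v∈I)

    τsum-exchange<τsum : τsum (exchange I v u) < τsum I
    τsum-exchange<τsum = sumℕ-exchange-< (τval τ) v∈I u∉I (s≤s τ#u<τ#v)

  Unchanged : Subset n → Set ℓ
  Unchanged I = (∀ {x} → x ∈ I → ¬ a ≤Q x) ⊎ (∀ {x} → x <Q a → x ∈ I)

  data View (I : Subset n) : Subset n → Set ℓ where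
    exchanged : ∀ {v u} → Exchange I v u → View I (exchange I v u)
    unchanged : Unchanged I → View I I

  view : ∀ I → View I (φa I)
  view I with pickMax τ (inA _≤Q?_ τ a I) | pickMax-extremum τ (inA _≤Q?_ τ a I)
            | pickMin τ (inB _≤Q?_ τ a I) | pickMin-extremum τ (inB _≤Q?_ τ a I)
  ... | just v | best pv v-best | just u | best pu u-best = exchanged record
    { v∈I = proj₁ (inA-sound I pv)
    ; a≤v = proj₂ (inA-sound I pv)
    ; v-last = λ x∈I a≤x → v-best (∈-allFin _) (inA-complete x∈I a≤x)
    ; u∉I = proj₁ (inB-sound I pu)
    ; u<a = proj₂ (inB-sound I pu)
    ; u-first = λ x∉I x<a → u-best (∈-allFin _) (inB-complete x∉I x<a)
    }
  ... | nothing | none no-A | _ | _ = unchanged (inj₁ λ x∈I a≤x →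
    ≡false⇒≢true (no-A (∈-allFin _)) (inA-complete x∈I a≤x))
  ... | just _ | _ | nothing | none no-B = unchanged (inj₂ λ {x} x<a → decidable-stable (x ∈? I) λ x∉I →
    ≡false⇒≢true (no-B (∈-allFin _)) (inB-complete x∉I x<a))

  module _ {ℓ′} {_≤P_ : Rel (Fin n) ℓ′} (P⊆Q : ∀ {u v} → u ≤P v → u ≤Q v) where

    exchange-preserves-ideal : ∀ {I v u} → Exchange I v u → IsIdeal _≤P_ I → IsIdeal _≤P_ (exchange I v u)
    exchange-preserves-ideal {I} {v} {u} e ideal {x} {y} y∈ x≤Py with exchange-∈⁻ y∈
    ... | inj₂ (y∈I , y≢v) = exchange-∈⁺ λ _ → ideal y∈I x≤Py , x≢v
      where
      open Exchange e
      x≢v : x ≢ v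
      x≢v refl = y≢v (τ#-injective (v-last y∈I (≤Q-trans a≤v (P⊆Q x≤Py))) (τ#-mono (P⊆Q x≤Py)))
    ... | inj₁ refl = exchange-∈⁺ λ x≢u → x∈I x≢u , x≢v
      where
      open Exchange e
      x≤u = P⊆Q x≤Py
      x≢v : x ≢ v
      x≢v refl = u≢a (≤Q-antisym u≤a (≤Q-trans a≤v x≤u))
      x<a : x <Q a
      x<a = ≤Q-trans x≤u u≤a , λ { refl → u≢a (≤Q-antisym u≤a x≤u) }
      x∈I : x ≢ u → x ∈ I
      x∈I x≢u = decidable-stable (x ∈? I) λ x∉I → x≢u (τ#-injective (τ#-mono x≤u) (u-first x∉I x<a))

    φ-preserves-ideal : ∀ {I} → IsIdeal _≤P_ I → IsIdeal _≤P_ (φa I)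
    φ-preserves-ideal {I} ideal with φa I | view I
    ... | _ | exchanged e = exchange-preserves-ideal e ideal
    ... | _ | unchanged _ = ideal

  φ-preserves-size : ∀ I → ∣ φa I ∣ ≡ ∣ I ∣
  φ-preserves-size I with φa I | view I
  ... | _ | exchanged e = ∣exchange∣≡∣I∣ (Exchange.v∈I e) (Exchange.u∉I e)
  ... | _ | unchanged _ = refl

  module _ {c ℓ₁ ℓ₂} (M : OrderedCommutativeMonoid c ℓ₁ ℓ₂)
           (ω : Fin n → OrderedCommutativeMonoid.Carrier M)
           (ω-mono : ∀ {u v} → u ≤Q v → OrderedCommutativeMonoid._≤_ M (ω u) (ω v)) where

    weight-φ≤weight : ∀ I → OrderedCommutativeMonoid._≤_ M (weight M ω (φa I)) (weight M ω I)
    weight-φ≤weight I with φa I | view I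
    ... | _ | exchanged e = weight-exchange-≤ M ω v∈I u∉I (ω-mono (≤Q-trans u≤a a≤v))
      where open Exchange e
    ... | _ | unchanged _ = IsPreorder.refl (OrderedCommutativeMonoid.≤-isPreorder M)

  exchange-monotone : ∀ {I J vI uI vJ uJ} → I ⊆ J → Exchange I vI uI → Exchange J vJ uJ →
                      exchange I vI uI ⊆ exchange J vJ uJ
  exchange-monotone {I} {J} {vI} {uI} {vJ} {uJ} I⊆J eI eJ = exchange-⊆ uI∈φJ λ x∈I x≢vI →
    exchange-∈⁺ λ _ → I⊆J x∈I , λ { refl → x≢vI (vJ≡vI x∈I) }
    where
    module I = Exchange eI
    module J = Exchange eJ
    vJ≡vI : vJ ∈ I → vJ ≡ vI
    vJ≡vI vJ∈I = τ#-injective (I.v-last vJ∈I J.a≤v) (J.v-last (I⊆J I.v∈I) I.a≤v)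
    uI∈J : uI ≢ uJ → uI ∈ J
    uI∈J uI≢uJ = decidable-stable (uI ∈? J) λ uI∉J →
      uI≢uJ (τ#-injective (I.u-first (J.u∉I ∘ I⊆J) J.u<a) (J.u-first uI∉J I.u<a))
    uI∈φJ : uI ∈ exchange J vJ uJ
    uI∈φJ = exchange-∈⁺ λ uI≢uJ → uI∈J uI≢uJ , λ { refl → I.u≢a (≤Q-antisym I.u≤a J.a≤v) }

  φ-monotone : ∀ {I J} → I ⊆ J → φa I ⊆ φa J
  φ-monotone {I} {J} I⊆J with φa I | view I | φa J | view J
  ... | _ | exchanged eI | _ | exchanged eJ = exchange-monotone I⊆J eI eJ
  ... | _ | unchanged _ | _ | unchanged _ = I⊆J
  ... | _ | unchanged (inj₁ no-A) | _ | exchanged eJ =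
    λ x∈I → exchange-∈⁺ λ _ → I⊆J x∈I , λ { refl → no-A x∈I (Exchange.a≤v eJ) }
  ... | _ | unchanged (inj₂ no-B) | _ | exchanged eJ =
    contradiction (I⊆J (no-B (Exchange.u<a eJ))) (Exchange.u∉I eJ)
  ... | _ | exchanged eI | _ | unchanged (inj₁ no-A) =
    contradiction (Exchange.a≤v eI) (no-A (I⊆J (Exchange.v∈I eI)))
  ... | _ | exchanged eI | _ | unchanged (inj₂ no-B) =
    exchange-⊆ (no-B (Exchange.u<a eI)) λ x∈I _ → I⊆J x∈I

  τsum-φ≤τsum : ∀ I → τsum (φa I) ≤ τsum I
  τsum-φ≤τsum I with φa I | view I
  ... | _ | exchanged e = <⇒≤ (Exchange.τsum-exchange<τsum e)
  ... | _ | unchanged _ = ≤-refl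

  τsum-φ≡τsum⇒φ≡ : ∀ I → τsum (φa I) ≡ τsum I → φa I ≡ I
  τsum-φ≡τsum⇒φ≡ I with φa I | view I
  ... | _ | exchanged e = λ eq → contradiction eq (<⇒≢ (Exchange.τsum-exchange<τsum e))
  ... | _ | unchanged _ = λ _ → refl

theorem4 : ∀ {c ℓ₁ ℓ₂} (M : OrderedCommutativeMonoid c ℓ₁ ℓ₂) (n : ℕ)
    (_≤P_ : Rel (Fin n) 0ℓ) (_≤Q_ : Rel (Fin n) 0ℓ)
    (P-po : IsPartialOrder _≡_ _≤P_) (Q-po : IsDecPartialOrder _≡_ _≤Q_)
    (P⊆Q : ∀ {u v} → u ≤P v → u ≤Q v)
    (ω : Fin n → OrderedCommutativeMonoid.Carrier M)
    (ω-mono : ∀ {u v} → u ≤Q v → OrderedCommutativeMonoid._≤_ M (ω u) (ω v))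
    (τ : Fin n → Fin n) (τ-bij : Bijective _≡_ _≡_ τ)
    (τ-mono : ∀ {u v} → u ≤Q v → τval τ u ≤ τval τ v)
    (a : Fin n) →
    let φa = φ (IsDecPartialOrder._≤?_ Q-po) τ a in
    (∀ I → IsIdeal _≤P_ I → IsIdeal _≤P_ (φa I))
    × (∀ I → IsIdeal _≤P_ I → ∣ φa I ∣ ≡ ∣ I ∣)
    × (∀ I → IsIdeal _≤P_ I →
         OrderedCommutativeMonoid._≤_ M (weight M ω (φa I)) (weight M ω I))
    × (∀ I J → IsIdeal _≤P_ I → IsIdeal _≤P_ J → I ⊆ J → φa I ⊆ φa J)
    × (∀ I → IsIdeal _≤P_ I →
         (sumℕ (τval τ) (φa I) ≤ sumℕ (τval τ) I)
         × (sumℕ (τval τ) (φa I) ≡ sumℕ (τval τ) I ⇔ φa I ≡ I))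
theorem4 M n _≤P_ _≤Q_ _ Q-po P⊆Q ω ω-mono τ τ-bij τ-mono a =
    (λ _ → φ-preserves-ideal P⊆Q)
  , (λ I _ → φ-preserves-size I)
  , (λ I _ → weight-φ≤weight M ω ω-mono I)
  , (λ _ _ _ _ → φ-monotone)
  , (λ I _ → τsum-φ≤τsum I , mk⇔ (τsum-φ≡τsum⇒φ≡ I) (≡.cong τsum))
  where open ExchangeOperation Q-po τ (proj₁ τ-bij) τ-mono a
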